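{- Let $H=\left(\frac{ -1,-3}{\mathbb{Q}}\right)$ with standard basis $\{1,i,j,k\}$ ($i^2=-1$, $j^2=-3$, $k=ij$), let $\mathcal{O}\subseteq H$ be the maximal order with $\mathbb{Z}$-basis $\{1,i,\tfrac{i+j}{2},\tfrac{1+k}{2}\}$, and let $p$ be an odd prime. A quaternion $\alpha=a_0+a_1i+a_2j+a_3k\in H$ belongs to the set $A:=\{\alpha\in\mathcal{O}\mid\alpha\equiv1\bmod 2\mathcal{O},\ \mathrm{Nm}(\alpha)=p\}$ if and only if (i) $a_0,a_1,a_2,a_3\in\mathbb{Z}$; (ii) $a_0^2+a_1^2+3a_2^2+3a_3^2=p$; (iii) $a_0+a_3\equiv1\bmod 2$ and $a_1+a_2\equiv0\bmod2$.
   Context: $\mathrm{Nm}$ is the reduced norm, $\mathrm{Nm}(a_0+a_1i+a_2j+a_3k)=a_0^2+a_1^2+3a_2^2+3a_3^2$. -}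

module Defs where

open import Data.Nat using (ℕ)
open import Data.Integer as ℤ using (ℤ; +_)
open import Data.Integer.Divisibility as ℤD using ()
open import Data.Rational using (ℚ; _/_; 0ℚ; 1ℚ; ½; _+_; _*_; _-_)
open import Data.Product using (Σ; _×_; ∃)
open import Relation.Binary.PropositionalEquality using (_≡_)

-- Elements of H = (-1,-3 / ℚ), written a0 + a1 i + a2 j + a3 k
record ℍ : Set where
  constructor ⟨_,_,_,_⟩
  field
    a0 a1 a2 a3 : ℚ
open ℍ public

ι : ℤ → ℚ
ι z = z / 1

infixl 6 _+ₕ_ _-ₕ_
infixl 7 _·ₕ_

_+ₕ_ : ℍ → ℍ → ℍ
⟨ a , b , c , d ⟩ +ₕ ⟨ a' , b' , c' , d' ⟩ = ⟨ a + a' , b + b' , c + c' , d + d' ⟩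

_-ₕ_ : ℍ → ℍ → ℍ
⟨ a , b , c , d ⟩ -ₕ ⟨ a' , b' , c' , d' ⟩ = ⟨ a - a' , b - b' , c - c' , d - d' ⟩

_·ₕ_ : ℚ → ℍ → ℍ
q ·ₕ ⟨ a , b , c , d ⟩ = ⟨ q * a , q * b , q * c , q * d ⟩

𝟙 𝕚 ω η : ℍ
𝟙 = ⟨ 1ℚ , 0ℚ , 0ℚ , 0ℚ ⟩
𝕚 = ⟨ 0ℚ , 1ℚ , 0ℚ , 0ℚ ⟩
ω = ⟨ 0ℚ , ½ , ½ , 0ℚ ⟩
η = ⟨ ½ , 0ℚ , 0ℚ , ½ ⟩

InO : ℍ → Set
InO α = Σ ℤ λ x0 → Σ ℤ λ x1 → Σ ℤ λ x2 → Σ ℤ λ x3 →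
  α ≡ ι x0 ·ₕ 𝟙 +ₕ ι x1 ·ₕ 𝕚 +ₕ ι x2 ·ₕ ω +ₕ ι x3 ·ₕ η

Nm : ℍ → ℚ
Nm ⟨ a , b , c , d ⟩ = a * a + b * b + ι (+ 3) * (c * c) + ι (+ 3) * (d * d)

Cong1mod2O : ℍ → Set
Cong1mod2O α = ∃ λ β → InO β × (α -ₕ 𝟙 ≡ ι (+ 2) ·ₕ β)

InA : ℕ → ℍ → Set
InA p α = InO α × Cong1mod2O α × (Nm α ≡ ι (+ p))

Conds : ℕ → ℍ → Set
Conds p α = Σ ℤ λ b0 → Σ ℤ λ b1 → Σ ℤ λ b2 → Σ ℤ λ b3 →
  (a0 α ≡ ι b0) × (a1 α ≡ ι b1) × (a2 α ≡ ι b2) × (a3 α ≡ ι b3) ×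
  (Nm α ≡ ι (+ p)) ×
  ((+ 2) ℤD.∣ (b0 ℤ.+ b3 ℤ.- + 1)) × ((+ 2) ℤD.∣ (b1 ℤ.+ b2))

-- Write β ∈ O as x0 + x1 i + x2 (i+j)/2 + x3 (1+k)/2. Then
-- 2β = (2x0 + x3) + (2x1 + x2) i + x2 j + x3 k, so α = 1 + 2β has integer
-- coordinates with a0 + a3 = 1 + 2(x0 + x3) odd and a1 + a2 = 2(x1 + x2) even.
-- Conversely, these two parities are exactly what is needed to solve for
-- x0 = (a0 + a3 - 1)/2 - a3 and x1 = (a1 + a2)/2 - a2, and every quaternion
-- with integer coordinates lies in O.
module Submission where

open import Defs
open import Data.Integer as ℤ using (ℤ; +_; -[1+_])
import Data.Integer.Divisibility as ℤD
import Data.Integer.Divisibility.Signed as ℤS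
import Data.Integer.Properties as ℤ
import Data.Integer.Tactic.RingSolver as ℤ-Ring
open import Data.List using (_∷_; [])
open import Data.Nat as ℕ using (ℕ)
open import Data.Nat.Coprimality using (1-coprimeTo) renaming (sym to coprime-sym)
open import Data.Nat.Divisibility using (_∣_)
open import Data.Nat.Primality using (Prime)
open import Data.Product using (Σ; _×_; _,_)
open import Data.Rational using (mkℚ; 0ℚ; 1ℚ; ½; _+_; _*_; _-_; -_)
open import Data.Rational.Properties using (↥p/↧p≡p; +-identityʳ)
open import Data.Rational.Solver using (module +-*-Solver)
open import Function.Bundles using (_⇔_; mk⇔; Equivalence)
open import Relation.Binary.PropositionalEquality
open import Relation.Nullary using (¬_)

open Equivalence using (to; from)
open ≡-Reasoning

-- ι z is a normalised fraction; as a literal mkℚ, ℚ arithmetic on it computes.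
ι≡mkℚ : ∀ z → ι z ≡ mkℚ z 0 (coprime-sym (1-coprimeTo ℤ.∣ z ∣))
ι≡mkℚ z = ↥p/↧p≡p (mkℚ z 0 _)

ι-homo-+ : ∀ a b → ι (a ℤ.+ b) ≡ ι a + ι b
ι-homo-+ a b rewrite ι≡mkℚ a | ι≡mkℚ b =
  cong₂ (λ x y → ι (x ℤ.+ y)) (sym (ℤ.*-identityʳ a)) (sym (ℤ.*-identityʳ b))

ι-homo-* : ∀ a b → ι (a ℤ.* b) ≡ ι a * ι b
ι-homo-* a b rewrite ι≡mkℚ a | ι≡mkℚ b = refl

ι-homo-neg : ∀ a → ι (ℤ.- a) ≡ - ι a
ι-homo-neg (+ 0)         = refl
ι-homo-neg (+ (ℕ.suc n)) = refl
ι-homo-neg -[1+ n ]      = trans (ι≡mkℚ (+ ℕ.suc n)) (cong -_ (sym (ι≡mkℚ -[1+ n ])))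

ι-homo-sub : ∀ a b → ι (a ℤ.- b) ≡ ι a - ι b
ι-homo-sub a b = trans (ι-homo-+ a (ℤ.- b)) (cong (λ q → ι a + q) (ι-homo-neg b))

⟨,,,⟩-cong : ∀ {a b c d a′ b′ c′ d′} → a ≡ a′ → b ≡ b′ → c ≡ c′ → d ≡ d′ →
             ⟨ a , b , c , d ⟩ ≡ ⟨ a′ , b′ , c′ , d′ ⟩
⟨,,,⟩-cong refl refl refl refl = refl

fromOBasis : ℤ → ℤ → ℤ → ℤ → ℍ
fromOBasis x0 x1 x2 x3 = ι x0 ·ₕ 𝟙 +ₕ ι x1 ·ₕ 𝕚 +ₕ ι x2 ·ₕ ω +ₕ ι x3 ·ₕ η

ℤ⟨_,_,_,_⟩ : ℤ → ℤ → ℤ → ℤ → ℍ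
ℤ⟨ b0 , b1 , b2 , b3 ⟩ = ⟨ ι b0 , ι b1 , ι b2 , ι b3 ⟩

twice-fromOBasis : ∀ x0 x1 x2 x3 → ι (+ 2) ·ₕ fromOBasis x0 x1 x2 x3 ≡
                   ℤ⟨ x0 ℤ.* + 2 ℤ.+ x3 , x1 ℤ.* + 2 ℤ.+ x2 , x2 , x3 ⟩
twice-fromOBasis x0 x1 x2 x3
  rewrite ι-homo-+ (x0 ℤ.* + 2) x3 | ι-homo-+ (x1 ℤ.* + 2) x2
        | ι-homo-* x0 (+ 2) | ι-homo-* x1 (+ 2) =
  ⟨,,,⟩-cong (a₀ (ι x0) (ι x1) (ι x2) (ι x3)) (a₁ (ι x0) (ι x1) (ι x2) (ι x3))
             (a₂ (ι x0) (ι x1) (ι x2) (ι x3)) (a₃ (ι x0) (ι x1) (ι x2) (ι x3))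
  where
  open +-*-Solver
  two = ι (+ 2)
  a₀ : ∀ X0 X1 X2 X3 → two * (X0 * 1ℚ + X1 * 0ℚ + X2 * 0ℚ + X3 * ½) ≡ X0 * two + X3
  a₀ = solve 4 (λ X0 X1 X2 X3 → con two :* (X0 :* con 1ℚ :+ X1 :* con 0ℚ :+ X2 :* con 0ℚ :+ X3 :* con ½)
                                := X0 :* con two :+ X3) refl
  a₁ : ∀ X0 X1 X2 X3 → two * (X0 * 0ℚ + X1 * 1ℚ + X2 * ½ + X3 * 0ℚ) ≡ X1 * two + X2
  a₁ = solve 4 (λ X0 X1 X2 X3 → con two :* (X0 :* con 0ℚ :+ X1 :* con 1ℚ :+ X2 :* con ½ :+ X3 :* con 0ℚ)
                                := X1 :* con two :+ X2) refl
  a₂ : ∀ X0 X1 X2 X3 → two * (X0 * 0ℚ + X1 * 0ℚ + X2 * ½ + X3 * 0ℚ) ≡ X2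
  a₂ = solve 4 (λ X0 X1 X2 X3 → con two :* (X0 :* con 0ℚ :+ X1 :* con 0ℚ :+ X2 :* con ½ :+ X3 :* con 0ℚ)
                                := X2) refl
  a₃ : ∀ X0 X1 X2 X3 → two * (X0 * 0ℚ + X1 * 0ℚ + X2 * 0ℚ + X3 * ½) ≡ X3
  a₃ = solve 4 (λ X0 X1 X2 X3 → con two :* (X0 :* con 0ℚ :+ X1 :* con 0ℚ :+ X2 :* con 0ℚ :+ X3 :* con ½)
                                := X3) refl

ℤ⟨⟩-+ₕ𝟙 : ∀ b0 b1 b2 b3 → ℤ⟨ b0 , b1 , b2 , b3 ⟩ +ₕ 𝟙 ≡ ℤ⟨ b0 ℤ.+ + 1 , b1 , b2 , b3 ⟩
ℤ⟨⟩-+ₕ𝟙 b0 b1 b2 b3 = ⟨,,,⟩-cong (sym (ι-homo-+ b0 (+ 1)))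
  (+-identityʳ (ι b1)) (+-identityʳ (ι b2)) (+-identityʳ (ι b3))

-ₕ𝟙≡⇔≡+ₕ𝟙 : ∀ {α β} → (α -ₕ 𝟙 ≡ β) ⇔ (α ≡ β +ₕ 𝟙)
-ₕ𝟙≡⇔≡+ₕ𝟙 {⟨ a , b , c , d ⟩} {⟨ a′ , b′ , c′ , d′ ⟩} = mk⇔
  (λ { refl → ⟨,,,⟩-cong (x≡x-y+y a 1ℚ) (x≡x-y+y b 0ℚ) (x≡x-y+y c 0ℚ) (x≡x-y+y d 0ℚ) })
  (λ { refl → ⟨,,,⟩-cong (x+y-y≡x a′ 1ℚ) (x+y-y≡x b′ 0ℚ) (x+y-y≡x c′ 0ℚ) (x+y-y≡x d′ 0ℚ) })
  where
  open +-*-Solver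
  x≡x-y+y : ∀ x y → x ≡ x - y + y
  x≡x-y+y = solve 2 (λ x y → x := x :- y :+ y) refl
  x+y-y≡x : ∀ x y → x + y - y ≡ x
  x+y-y≡x = solve 2 (λ x y → x :+ y :- y := x) refl

ℤ⟨⟩∈O : ∀ b0 b1 b2 b3 → InO ℤ⟨ b0 , b1 , b2 , b3 ⟩
ℤ⟨⟩∈O b0 b1 b2 b3 = b0 ℤ.- b3 , b1 ℤ.- b2 , b2 ℤ.* + 2 , b3 ℤ.* + 2 , coordinates
  where
  open +-*-Solver
  two = ι (+ 2)
  a₀ : ∀ X0 X1 X2 X3 → X0 ≡ (X0 - X3) * 1ℚ + (X1 - X2) * 0ℚ + (X2 * two) * 0ℚ + (X3 * two) * ½
  a₀ = solve 4 (λ X0 X1 X2 X3 → X0 := (X0 :- X3) :* con 1ℚ :+ (X1 :- X2) :* con 0ℚ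
                                       :+ (X2 :* con two) :* con 0ℚ :+ (X3 :* con two) :* con ½) refl
  a₁ : ∀ X0 X1 X2 X3 → X1 ≡ (X0 - X3) * 0ℚ + (X1 - X2) * 1ℚ + (X2 * two) * ½ + (X3 * two) * 0ℚ
  a₁ = solve 4 (λ X0 X1 X2 X3 → X1 := (X0 :- X3) :* con 0ℚ :+ (X1 :- X2) :* con 1ℚ
                                       :+ (X2 :* con two) :* con ½ :+ (X3 :* con two) :* con 0ℚ) refl
  a₂ : ∀ X0 X1 X2 X3 → X2 ≡ (X0 - X3) * 0ℚ + (X1 - X2) * 0ℚ + (X2 * two) * ½ + (X3 * two) * 0ℚ
  a₂ = solve 4 (λ X0 X1 X2 X3 → X2 := (X0 :- X3) :* con 0ℚ :+ (X1 :- X2) :* con 0ℚ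
                                       :+ (X2 :* con two) :* con ½ :+ (X3 :* con two) :* con 0ℚ) refl
  a₃ : ∀ X0 X1 X2 X3 → X3 ≡ (X0 - X3) * 0ℚ + (X1 - X2) * 0ℚ + (X2 * two) * 0ℚ + (X3 * two) * ½
  a₃ = solve 4 (λ X0 X1 X2 X3 → X3 := (X0 :- X3) :* con 0ℚ :+ (X1 :- X2) :* con 0ℚ
                                       :+ (X2 :* con two) :* con 0ℚ :+ (X3 :* con two) :* con ½) refl
  coordinates : ℤ⟨ b0 , b1 , b2 , b3 ⟩ ≡ fromOBasis (b0 ℤ.- b3) (b1 ℤ.- b2) (b2 ℤ.* + 2) (b3 ℤ.* + 2)
  coordinates rewrite ι-homo-sub b0 b3 | ι-homo-sub b1 b2 | ι-homo-* b2 (+ 2) | ι-homo-* b3 (+ 2) =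
    ⟨,,,⟩-cong (a₀ (ι b0) (ι b1) (ι b2) (ι b3)) (a₁ (ι b0) (ι b1) (ι b2) (ι b3))
               (a₂ (ι b0) (ι b1) (ι b2) (ι b3)) (a₃ (ι b0) (ι b1) (ι b2) (ι b3))

odd-sum-split : ∀ x y {k} → x ℤ.+ y ℤ.- + 1 ≡ k ℤ.* + 2 → x ≡ (k ℤ.- y) ℤ.* + 2 ℤ.+ y ℤ.+ + 1
odd-sum-split x y {k} x+y-1≡2k = begin
  x                                            ≡⟨ ℤ-Ring.solve (x ∷ y ∷ []) ⟩
  x ℤ.+ y ℤ.- + 1 ℤ.- y ℤ.* + 2 ℤ.+ y ℤ.+ + 1  ≡⟨ cong (λ s → s ℤ.- y ℤ.* + 2 ℤ.+ y ℤ.+ + 1) x+y-1≡2k ⟩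
  k ℤ.* + 2 ℤ.- y ℤ.* + 2 ℤ.+ y ℤ.+ + 1        ≡⟨ ℤ-Ring.solve (k ∷ y ∷ []) ⟩
  (k ℤ.- y) ℤ.* + 2 ℤ.+ y ℤ.+ + 1              ∎

even-sum-split : ∀ x y {m} → x ℤ.+ y ≡ m ℤ.* + 2 → x ≡ (m ℤ.- y) ℤ.* + 2 ℤ.+ y
even-sum-split x y {m} x+y≡2m = begin
  x                              ≡⟨ ℤ-Ring.solve (x ∷ y ∷ []) ⟩
  x ℤ.+ y ℤ.- y ℤ.* + 2 ℤ.+ y    ≡⟨ cong (λ s → s ℤ.- y ℤ.* + 2 ℤ.+ y) x+y≡2m ⟩
  m ℤ.* + 2 ℤ.- y ℤ.* + 2 ℤ.+ y  ≡⟨ ℤ-Ring.solve (m ∷ y ∷ []) ⟩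
  (m ℤ.- y) ℤ.* + 2 ℤ.+ y        ∎

IntegralWithParity : ℍ → Set
IntegralWithParity α = Σ ℤ λ b0 → Σ ℤ λ b1 → Σ ℤ λ b2 → Σ ℤ λ b3 →
  (α ≡ ℤ⟨ b0 , b1 , b2 , b3 ⟩) × ((+ 2) ℤD.∣ (b0 ℤ.+ b3 ℤ.- + 1)) × ((+ 2) ℤD.∣ (b1 ℤ.+ b2))

∣ᵤ-intro : ∀ {k z} q → z ≡ q ℤ.* k → k ℤD.∣ z
∣ᵤ-intro q z≡qk = ℤS.∣⇒∣ᵤ (ℤS.divides q z≡qk)

Cong1mod2O⇒IntegralWithParity : ∀ {α} → Cong1mod2O α → IntegralWithParity α
Cong1mod2O⇒IntegralWithParity {α} (_ , (y0 , y1 , y2 , y3 , refl) , α-𝟙≡2β) =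
  c0 ℤ.+ + 1 , c1 , y2 , y3 , α≡ℤ⟨c⟩ ,
  ∣ᵤ-intro (y0 ℤ.+ y3) odd , ∣ᵤ-intro (y1 ℤ.+ y2) even
  where
  c0 = y0 ℤ.* + 2 ℤ.+ y3
  c1 = y1 ℤ.* + 2 ℤ.+ y2
  odd : y0 ℤ.* + 2 ℤ.+ y3 ℤ.+ + 1 ℤ.+ y3 ℤ.- + 1 ≡ (y0 ℤ.+ y3) ℤ.* + 2
  odd = ℤ-Ring.solve (y0 ∷ y3 ∷ [])
  even : y1 ℤ.* + 2 ℤ.+ y2 ℤ.+ y2 ≡ (y1 ℤ.+ y2) ℤ.* + 2
  even = ℤ-Ring.solve (y1 ∷ y2 ∷ [])
  α≡ℤ⟨c⟩ : α ≡ ℤ⟨ c0 ℤ.+ + 1 , c1 , y2 , y3 ⟩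
  α≡ℤ⟨c⟩ = begin
    α                                       ≡⟨ to -ₕ𝟙≡⇔≡+ₕ𝟙 α-𝟙≡2β ⟩
    ι (+ 2) ·ₕ fromOBasis y0 y1 y2 y3 +ₕ 𝟙  ≡⟨ cong (_+ₕ 𝟙) (twice-fromOBasis y0 y1 y2 y3) ⟩
    ℤ⟨ c0 , c1 , y2 , y3 ⟩ +ₕ 𝟙             ≡⟨ ℤ⟨⟩-+ₕ𝟙 c0 c1 y2 y3 ⟩
    ℤ⟨ c0 ℤ.+ + 1 , c1 , y2 , y3 ⟩          ∎

IntegralWithParity⇒Cong1mod2O : ∀ {α} → IntegralWithParity α → Cong1mod2O α
IntegralWithParity⇒Cong1mod2O (b0 , b1 , b2 , b3 , refl , 2∣b0+b3-1 , 2∣b1+b2)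
  with ℤS.∣ᵤ⇒∣ {k = + 2} {i = b0 ℤ.+ b3 ℤ.- + 1} 2∣b0+b3-1
     | ℤS.∣ᵤ⇒∣ {k = + 2} {i = b1 ℤ.+ b2} 2∣b1+b2
... | ℤS.divides k b0+b3-1≡2k | ℤS.divides m b1+b2≡2m =
  fromOBasis x0 x1 b2 b3 , (x0 , x1 , b2 , b3 , refl) , from -ₕ𝟙≡⇔≡+ₕ𝟙 (begin
    ℤ⟨ b0 , b1 , b2 , b3 ⟩
      ≡⟨ cong₂ (λ u v → ℤ⟨ u , v , b2 , b3 ⟩)
               (odd-sum-split b0 b3 {k} b0+b3-1≡2k) (even-sum-split b1 b2 {m} b1+b2≡2m) ⟩
    ℤ⟨ x0 ℤ.* + 2 ℤ.+ b3 ℤ.+ + 1 , x1 ℤ.* + 2 ℤ.+ b2 , b2 , b3 ⟩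
      ≡⟨ ℤ⟨⟩-+ₕ𝟙 (x0 ℤ.* + 2 ℤ.+ b3) (x1 ℤ.* + 2 ℤ.+ b2) b2 b3 ⟨
    ℤ⟨ x0 ℤ.* + 2 ℤ.+ b3 , x1 ℤ.* + 2 ℤ.+ b2 , b2 , b3 ⟩ +ₕ 𝟙
      ≡⟨ cong (_+ₕ 𝟙) (twice-fromOBasis x0 x1 b2 b3) ⟨
    ι (+ 2) ·ₕ fromOBasis x0 x1 b2 b3 +ₕ 𝟙
      ∎)
  where
  x0 = k ℤ.- b3
  x1 = m ℤ.- b2

IntegralWithParity⇒InO : ∀ {α} → IntegralWithParity α → InO α
IntegralWithParity⇒InO (b0 , b1 , b2 , b3 , refl , _) = ℤ⟨⟩∈O b0 b1 b2 b3

Conds⇔IntegralWithParity×Nm : ∀ p α → Conds p α ⇔ (IntegralWithParity α × Nm α ≡ ι (+ p))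
Conds⇔IntegralWithParity×Nm p α = mk⇔
  (λ (b0 , b1 , b2 , b3 , a0≡ , a1≡ , a2≡ , a3≡ , Nα≡p , odd , even) →
     (b0 , b1 , b2 , b3 , ⟨,,,⟩-cong a0≡ a1≡ a2≡ a3≡ , odd , even) , Nα≡p)
  (λ { ((b0 , b1 , b2 , b3 , refl , odd , even) , Nα≡p) →
     b0 , b1 , b2 , b3 , refl , refl , refl , refl , Nα≡p , odd , even })

-- The norm condition is carried along unchanged: p need not be prime or odd.
mainTheorem11 : (p : ℕ) → Prime p → ¬ (2 ∣ p) →
    (α : ℍ) → InA p α ⇔ Conds p α
mainTheorem11 p _ _ α = mk⇔
  (λ (_ , α≡1 , Nα≡p) → from conds⇔ (Cong1mod2O⇒IntegralWithParity α≡1 , Nα≡p))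
  (λ conds → let (integral , Nα≡p) = to conds⇔ conds in
     IntegralWithParity⇒InO integral , IntegralWithParity⇒Cong1mod2O integral , Nα≡p)
  where
  conds⇔ : Conds p α ⇔ (IntegralWithParity α × Nm α ≡ ι (+ p))
  conds⇔ = Conds⇔IntegralWithParity×Nm p α
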